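{- Let $p$ be an odd prime and $m\ge1$ an integer, and let $\alpha_0^{(1)},\dots,\alpha_0^{(m)}\in\mathbb{Q}$. Run the $p$-adic Jacobi–Perron algorithm on this input: for $n=0,1,2,\dots$ $$a_n^{(i)}=s(\alpha_n^{(i)})\ (i=1,\dots,m),\quad \alpha_{n+1}^{(1)}=\frac{1}{\alpha_n^{(m)}-a_n^{(m)}},\quad \alpha_{n+1}^{(i)}=\frac{\alpha_n^{(i-1)}-a_n^{(i-1)}}{\alpha_n^{(m)}-a_n^{(m)}}\ (i=2,\dots,m),$$ where the algorithm stops at step $n$ if $\alpha_n^{(m)}=a_n^{(m)}$. Then the algorithm terminates after finitely many steps.
   Context: $s:\mathbb{Q}_p\to\mathbb{Q}$ is the Browkin function: writing $\alpha\in\mathbb{Q}_p$ uniquely as $\alpha=\sum_{j=k}^\infty x_jp^j$ with $k\in\mathbb{Z}$, $x_j\in\mathbb{Z}\cap(-\frac p2,\frac p2)$, set $s(\alpha)=\sum_{j=k}^0x_jp^j$. Rational numbers are viewed as elements of $\mathbb{Q}_p$. -}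

module Defs where

open import Data.Nat as ℕ using (ℕ; zero; suc)
open import Data.Nat.Divisibility using (_∣?_)
open import Data.Integer as ℤ using (ℤ; +_)
open import Data.Rational as ℚ using (ℚ; 0ℚ; ↥_; ↧ₙ_; _-_; _*_; _÷_; 1/_)
open import Data.Rational.Properties using (_≟_)
open import Data.List using (List; []; _∷_; map; filter; upTo)
open import Data.Vec using (Vec; []; _∷_; last; init; _∷ʳ_) renaming (map to vmap)
open import Data.Maybe using (Maybe; just; nothing; _>>=_)
open import Data.Product using (∃-syntax; _×_)
open import Relation.Nullary using (yes; no; ¬_)
open import Relation.Binary.PropositionalEquality using (_≡_)

balancedDigits : ℕ → List ℤ
balancedDigits p =
  filter (λ c → 2 ℕ.* ℤ.∣ c ∣ ℕ.<? p)
         (map (λ i → + i ℤ.- + p) (upTo (suc (2 ℕ.* p))))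

-- The 0-th balanced p-adic digit of x ∈ ℚ ∩ ℤ_p (p ∤ denominator of x):
-- the unique c ∈ ℤ ∩ (-p/2, p/2) with x - c ∈ pℤ_p, i.e. p divides the
-- numerator of x - c.  (Default 0 if no such c exists; never happens.)
digit0 : ℕ → ℚ → ℤ
digit0 p x with filter (λ c → p ∣? ℤ.∣ ↥ (x - (c ℚ./ 1)) ∣) (balancedDigits p)
... | []    = + 0
... | c ∷ _ = c

-- Browkin function, with fuel.  If p ∤ den(α) then α ∈ ℤ_p and s(α) = x_0.
-- Otherwise s(α) = t + x_0(α - t) with t = Σ_{j=k}^{-1} x_j p^j = s(pα)/p.
browkinFuel : ℕ → (p : ℕ) → .{{ℕ.NonZero p}} → ℚ → ℚ
browkinFuel zero p α = digit0 p α ℚ./ 1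
browkinFuel (suc f) p α with p ∣? ↧ₙ α
... | no _  = digit0 p α ℚ./ 1
... | yes _ =
  let t = browkinFuel f p ((+ p ℚ./ 1) * α) * (+ 1 ℚ./ p)
  in  t ℚ.+ (digit0 p (α - t) ℚ./ 1)

-- The Browkin function s : ℚ → ℚ (ℚ ⊂ ℚ_p).  The p-adic valuation of the
-- denominator is below the denominator, so this fuel suffices.
s : (p : ℕ) → .{{ℕ.NonZero p}} → ℚ → ℚ
s p α = browkinFuel (↧ₙ α) p α

jpStep : (p : ℕ) → .{{ℕ.NonZero p}} → {k : ℕ} → Vec ℚ (suc k) → Maybe (Vec ℚ (suc k))
jpStep p {k} α with last α - s p (last α) ≟ 0ℚ
... | yes _ = nothing
... | no d≢0 =
  let d  = last α - s p (last α)
      instance nz = ℚ.≢-nonZero d≢0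
      fr : Vec ℚ k
      fr = vmap (λ x → (x - s p x) ÷ d) (init α)
  in just ((1/ d) ∷ fr)

jpOrbit : (p : ℕ) → .{{ℕ.NonZero p}} → {k : ℕ} → ℕ → Vec ℚ (suc k) → Maybe (Vec ℚ (suc k))
jpOrbit p zero    α = just α
jpOrbit p (suc n) α = jpOrbit p n α >>= jpStep p

JPTerminates : (p : ℕ) → .{{ℕ.NonZero p}} → {k : ℕ} → Vec ℚ (suc k) → Set
JPTerminates p α = ∃[ n ] ∃[ β ] (jpOrbit p n α ≡ just β × last β ≡ s p (last β))

-- Write the current vector as α = x / (p^(k+1) y₀) with integral numerators x and p ∤ y₀.
-- The Browkin function gives p^(k+1) s(αᵢ) = cᵢ with |cᵢ| < p^(k+2)/2 and αᵢ − s(αᵢ) ∈ pℤₚ,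
-- so zᵢ = (αᵢ − s(αᵢ)) y₀ is an integer divisible by p with p^(k+1) |zᵢ| ≤ |xᵢ| + |cᵢ| |y₀|.
-- The next vector is (y₀, z₁, …, z_{m−1}) / z_m, of the same shape since p ∣ z_m, and the
-- weighted size Σ 2^(i−1) |xᵢ| + 2^m p^(k+1) |y₀| strictly decreases: the algorithm stops.
module Submission where

open import Defs
open import Data.Nat using (ℕ; suc; NonZero)
open import Data.Nat.Primality using (Prime)
open import Relation.Binary.PropositionalEquality using (_≢_)
open import Data.Rational using (ℚ)
open import Data.Vec using (Vec)

open import Data.Nat as ℕ using (zero; _^_; z≤n; s≤s)
import Data.Nat.Properties as ℕP
open import Data.Nat.Solver using () renaming (module +-*-Solver to ℕ-Solver)
open import Data.Integer as ℤ using (ℤ; +_; -[1+_])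
import Data.Integer.Properties as ℤP
open import Data.Integer.Solver using () renaming (module +-*-Solver to ℤ-Solver)
open import Data.Rational as ℚ using (mkℚ; 0ℚ; 1ℚ; ↥_; ↧_; ↧ₙ_; _-_; _*_; _+_; -_; 1/_; _÷_; toℚᵘ)
import Data.Rational.Properties as ℚP
open import Data.Rational.Solver using () renaming (module +-*-Solver to ℚ-Solver)
import Data.Rational.Unnormalised as ℚᵘ
import Data.Rational.Unnormalised.Properties as ℚᵘP
import Data.Nat.Coprimality as Coprimality
open import Data.Vec using ([]; _∷_; init; last) renaming (map to vmap)
import Data.Vec.Properties as VecP
open import Data.Vec.Relation.Binary.Pointwise.Inductive as PW using (Pointwise; []; _∷_)
open import Data.Nat.Divisibility as ℕ∣ using (_∣_; _∤_; divides; _∣?_)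
open import Data.Nat.Primality using (euclidsLemma; prime⇒nonZero; prime⇒nonTrivial; prime⇒irreducible)
open import Data.Nat.Induction using (<-wellFounded)
import Data.Integer.Divisibility.Signed as ℤ∣
import Data.Sign as Sign
open import Data.Maybe using (just; nothing; _>>=_)
import Data.Maybe.Properties as MaybeP
open import Data.Product using (Σ; _×_; _,_; proj₁; proj₂)
open import Data.Sum using (inj₁; inj₂; [_,_]′)
open import Data.Empty using (⊥; ⊥-elim)
open import Function using (_∘_)
open import Relation.Nullary using (yes; no)
open import Induction.WellFounded using (Acc; acc)
open import Relation.Binary.PropositionalEquality

-- Abstract, so that the type checker never unfolds the gcd normalisation inside z / 1.
abstract
  ι : ℤ → ℚ
  ι z = z ℚ./ 1

  ι-def : ∀ z → ι z ≡ z ℚ./ 1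
  ι-def z = refl

  private
    ι-mkℚ : ∀ z → ι z ≡ mkℚ z 0 (Coprimality.sym (Coprimality.1-coprimeTo ℤ.∣ z ∣))
    ι-mkℚ (+ n)    = ℚP.normalize-coprime (Coprimality.sym (Coprimality.1-coprimeTo n))
    ι-mkℚ -[1+ n ] = cong -_ (ℚP.normalize-coprime (Coprimality.sym (Coprimality.1-coprimeTo (suc n))))

    toℚᵘ-ι : ∀ z → toℚᵘ (ι z) ≡ ℚᵘ.mkℚᵘ z 0
    toℚᵘ-ι z rewrite ι-mkℚ z = refl

  ↥-ι : ∀ z → ↥ (ι z) ≡ z
  ↥-ι z rewrite ι-mkℚ z = refl

  ι-homo-+ : ∀ a b → ι (a ℤ.+ b) ≡ ι a + ι b
  ι-homo-+ a b = ℚP.toℚᵘ-injective (ℚᵘP.≃-trans (ℚᵘP.≃-reflexive (toℚᵘ-ι (a ℤ.+ b)))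
    (ℚᵘP.≃-trans (ℚᵘ.*≡* (ℤ-Solver.solve 2 (λ a b → (a :+ b) :* con (+ 1) := (a :* con (+ 1) :+ b :* con (+ 1)) :* con (+ 1)) refl a b))
      (ℚᵘP.≃-sym (ℚᵘP.≃-trans (ℚP.toℚᵘ-homo-+ (ι a) (ι b)) (ℚᵘP.≃-reflexive (cong₂ ℚᵘ._+_ (toℚᵘ-ι a) (toℚᵘ-ι b)))))))
    where open ℤ-Solver

  ι-homo-* : ∀ a b → ι (a ℤ.* b) ≡ ι a * ι b
  ι-homo-* a b = ℚP.toℚᵘ-injective (ℚᵘP.≃-trans (ℚᵘP.≃-reflexive (toℚᵘ-ι (a ℤ.* b)))
    (ℚᵘP.≃-trans (ℚᵘ.*≡* (ℤ-Solver.solve 2 (λ a b → (a :* b) :* con (+ 1) := (a :* b) :* con (+ 1)) refl a b))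
      (ℚᵘP.≃-sym (ℚᵘP.≃-trans (ℚP.toℚᵘ-homo-* (ι a) (ι b)) (ℚᵘP.≃-reflexive (cong₂ ℚᵘ._*_ (toℚᵘ-ι a) (toℚᵘ-ι b)))))))
    where open ℤ-Solver

  ι-homo-neg : ∀ a → ι (ℤ.- a) ≡ - ι a
  ι-homo-neg a = ℚP.toℚᵘ-injective (ℚᵘP.≃-trans (ℚᵘP.≃-reflexive (toℚᵘ-ι (ℤ.- a)))
    (ℚᵘP.≃-sym (ℚᵘP.≃-trans (ℚP.toℚᵘ-homo‿- (ι a)) (ℚᵘP.≃-reflexive (cong ℚᵘ.-_ (toℚᵘ-ι a))))))

  *-ι-↧ : ∀ x → x * ι (↧ x) ≡ ι (↥ x)
  *-ι-↧ x = ℚP.toℚᵘ-injective (ℚᵘP.≃-trans (ℚP.toℚᵘ-homo-* x (ι (↧ x)))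
    (ℚᵘP.≃-trans (ℚᵘP.≃-reflexive (cong (toℚᵘ x ℚᵘ.*_) (toℚᵘ-ι (↧ x))))
    (ℚᵘP.≃-trans (cancel x) (ℚᵘP.≃-reflexive (sym (toℚᵘ-ι (↥ x)))))))
    where
    open ℤ-Solver
    cancel : ∀ x → (toℚᵘ x ℚᵘ.* ℚᵘ.mkℚᵘ (↧ x) 0) ℚᵘ.≃ ℚᵘ.mkℚᵘ (↥ x) 0
    cancel (mkℚ n d _) = ℚᵘ.*≡* (solve 2 (λ n d → (n :* d) :* con (+ 1) := n :* (d :* con (+ 1))) refl n (+ suc d))

  /-*-ι : ∀ z n .{{_ : NonZero n}} → (z ℚ./ n) * ι (+ n) ≡ ι z
  /-*-ι z n@(suc d) = ℚP.toℚᵘ-injective (ℚᵘP.≃-trans (ℚP.toℚᵘ-homo-* (z ℚ./ n) (ι (+ n)))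
    (ℚᵘP.≃-trans (ℚᵘP.*-cong (ℚP.toℚᵘ-fromℚᵘ (ℚᵘ.mkℚᵘ z d)) (ℚᵘP.≃-reflexive (toℚᵘ-ι (+ n))))
    (ℚᵘP.≃-trans (ℚᵘ.*≡* (solve 2 (λ z n → (z :* n) :* con (+ 1) := z :* (n :* con (+ 1))) refl z (+ n)))
      (ℚᵘP.≃-reflexive (sym (toℚᵘ-ι z))))))
    where open ℤ-Solver

ι-1 : ι (+ 1) ≡ 1ℚ
ι-1 = ι-def (+ 1)

ι-injective : ∀ {a b} → ι a ≡ ι b → a ≡ b
ι-injective {a} {b} e = trans (sym (↥-ι a)) (trans (cong ↥_ e) (↥-ι b))

ι-homo-− : ∀ a b → ι (a ℤ.- b) ≡ ι a - ι b
ι-homo-− a b = trans (ι-homo-+ a (ℤ.- b)) (cong (λ w → ι a + w) (ι-homo-neg b))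

↥*≡*↧ : ∀ x a b → x * ι b ≡ ι a → ↥ x ℤ.* b ≡ a ℤ.* ↧ x
↥*≡*↧ x a b e = ι-injective (begin
  ι (↥ x ℤ.* b)        ≡⟨ ι-homo-* (↥ x) b ⟩
  ι (↥ x) * ι b        ≡⟨ cong (_* ι b) (*-ι-↧ x) ⟨
  x * ι (↧ x) * ι b    ≡⟨ solve 3 (λ x u v → x :* u :* v := (x :* v) :* u) refl x (ι (↧ x)) (ι b) ⟩
  (x * ι b) * ι (↧ x)  ≡⟨ cong (_* ι (↧ x)) e ⟩
  ι a * ι (↧ x)        ≡⟨ ι-homo-* a (↧ x) ⟨
  ι (a ℤ.* ↧ x)        ∎)
  where
  open ≡-Reasoning
  open ℚ-Solver

*-ι-scale : ∀ a D x c → a * ι D ≡ ι x → a * ι (D ℤ.* c) ≡ ι (x ℤ.* c)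
*-ι-scale a D x c aD≡x = begin
  a * ι (D ℤ.* c)   ≡⟨ cong (a *_) (ι-homo-* D c) ⟩
  a * (ι D * ι c)   ≡⟨ ℚP.*-assoc a (ι D) (ι c) ⟨
  a * ι D * ι c     ≡⟨ cong (_* ι c) aD≡x ⟩
  ι x * ι c         ≡⟨ ι-homo-* x c ⟨
  ι (x ℤ.* c)       ∎
  where open ≡-Reasoning

2*∣i+j*n∣<m*n : ∀ i j n m → 2 ℕ.* ℤ.∣ i ∣ ℕ.< n → 2 ℕ.* ℤ.∣ j ∣ ℕ.< m → 2 ℕ.* ℤ.∣ i ℤ.+ j ℤ.* + n ∣ ℕ.< m ℕ.* n
2*∣i+j*n∣<m*n i j n m 2∣i∣<n 2∣j∣<m = begin-strict
  2 ℕ.* ℤ.∣ i ℤ.+ j ℤ.* + n ∣              ≤⟨ ℕP.*-monoʳ-≤ 2 (ℤP.∣i+j∣≤∣i∣+∣j∣ i (j ℤ.* + n)) ⟩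
  2 ℕ.* (ℤ.∣ i ∣ ℕ.+ ℤ.∣ j ℤ.* + n ∣)      ≡⟨ cong (λ w → 2 ℕ.* (ℤ.∣ i ∣ ℕ.+ w)) (ℤP.abs-* j (+ n)) ⟩
  2 ℕ.* (ℤ.∣ i ∣ ℕ.+ ℤ.∣ j ∣ ℕ.* n)        ≡⟨ solve 3 (λ a b n → con 2 :* (a :+ b :* n) := con 2 :* a :+ con 2 :* b :* n) refl ℤ.∣ i ∣ ℤ.∣ j ∣ n ⟩
  2 ℕ.* ℤ.∣ i ∣ ℕ.+ 2 ℕ.* ℤ.∣ j ∣ ℕ.* n    <⟨ ℕP.+-monoˡ-< _ 2∣i∣<n ⟩
  suc (2 ℕ.* ℤ.∣ j ∣) ℕ.* n                ≤⟨ ℕP.*-monoˡ-≤ n 2∣j∣<m ⟩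
  m ℕ.* n                                  ∎
  where
  open ℕP.≤-Reasoning
  open ℕ-Solver

weight : ∀ {n} → Vec ℤ n → ℕ
weight []       = 0
weight (x ∷ xs) = ℤ.∣ x ∣ ℕ.+ 2 ℕ.* weight xs

-- 2ⁿ − 1, the weight of a vector of n ones
weightSum : ℕ → ℕ
weightSum zero    = 0
weightSum (suc n) = 1 ℕ.+ 2 ℕ.* weightSum n

weight-init-last : ∀ {n} (zs : Vec ℤ (suc n)) → weight zs ≡ weight (init zs) ℕ.+ suc (weightSum n) ℕ.* ℤ.∣ last zs ∣
weight-init-last (z ∷ []) = solve 1 (λ z → z :+ con 2 :* con 0 := con 0 :+ con 1 :* z) refl ℤ.∣ z ∣
  where open ℕ-Solver
weight-init-last {suc n} (z ∷ zs@(_ ∷ _)) = begin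
  ℤ.∣ z ∣ ℕ.+ 2 ℕ.* weight zs
    ≡⟨ cong (λ w → ℤ.∣ z ∣ ℕ.+ 2 ℕ.* w) (weight-init-last zs) ⟩
  ℤ.∣ z ∣ ℕ.+ 2 ℕ.* (weight (init zs) ℕ.+ suc (weightSum n) ℕ.* ℤ.∣ last zs ∣)
    ≡⟨ solve 4 (λ z w s l → z :+ con 2 :* (w :+ (con 1 :+ s) :* l) := (z :+ con 2 :* w) :+ (con 1 :+ (con 1 :+ con 2 :* s)) :* l) refl ℤ.∣ z ∣ (weight (init zs)) (weightSum n) ℤ.∣ last zs ∣ ⟩
  ℤ.∣ z ∣ ℕ.+ 2 ℕ.* weight (init zs) ℕ.+ suc (weightSum (suc n)) ℕ.* ℤ.∣ last zs ∣
    ∎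
  where
  open ≡-Reasoning
  open ℕ-Solver

weight-rotate : ∀ {n} y (zs : Vec ℤ (suc n)) →
                weight (y ∷ init zs) ℕ.+ suc (weightSum (suc n)) ℕ.* ℤ.∣ last zs ∣ ≡ ℤ.∣ y ∣ ℕ.+ 2 ℕ.* weight zs
weight-rotate {n} y zs = begin
  ℤ.∣ y ∣ ℕ.+ 2 ℕ.* weight (init zs) ℕ.+ suc (weightSum (suc n)) ℕ.* ℤ.∣ last zs ∣
    ≡⟨ solve 4 (λ y w s z → y :+ con 2 :* w :+ (con 1 :+ (con 1 :+ con 2 :* s)) :* z := y :+ con 2 :* (w :+ (con 1 :+ s) :* z)) refl ℤ.∣ y ∣ (weight (init zs)) (weightSum n) ℤ.∣ last zs ∣ ⟩
  ℤ.∣ y ∣ ℕ.+ 2 ℕ.* (weight (init zs) ℕ.+ suc (weightSum n) ℕ.* ℤ.∣ last zs ∣)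
    ≡⟨ cong (λ w → ℤ.∣ y ∣ ℕ.+ 2 ℕ.* w) (weight-init-last zs) ⟨
  ℤ.∣ y ∣ ℕ.+ 2 ℕ.* weight zs
    ∎
  where
  open ≡-Reasoning
  open ℕ-Solver

weight-combine : ∀ A B C {n} {xs zs : Vec ℤ n} → Pointwise (λ x z → A ℕ.* ℤ.∣ z ∣ ℕ.+ B ℕ.≤ 2 ℕ.* ℤ.∣ x ∣ ℕ.+ C) xs zs →
                 A ℕ.* weight zs ℕ.+ weightSum n ℕ.* B ℕ.≤ 2 ℕ.* weight xs ℕ.+ weightSum n ℕ.* C
weight-combine A B C [] = ℕP.≤-reflexive (solve 1 (λ A → A :* con 0 :+ con 0 := con 2 :* con 0 :+ con 0) refl A)
  where open ℕ-Solver
weight-combine A B C {suc n} {x ∷ xs} {z ∷ zs} (h ∷ hs) = begin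
  A ℕ.* (ℤ.∣ z ∣ ℕ.+ 2 ℕ.* weight zs) ℕ.+ (1 ℕ.+ 2 ℕ.* weightSum n) ℕ.* B
    ≡⟨ solve 5 (λ A z W s B → A :* (z :+ con 2 :* W) :+ (con 1 :+ con 2 :* s) :* B := (A :* z :+ B) :+ con 2 :* (A :* W :+ s :* B)) refl A ℤ.∣ z ∣ (weight zs) (weightSum n) B ⟩
  (A ℕ.* ℤ.∣ z ∣ ℕ.+ B) ℕ.+ 2 ℕ.* (A ℕ.* weight zs ℕ.+ weightSum n ℕ.* B)
    ≤⟨ ℕP.+-mono-≤ h (ℕP.*-monoʳ-≤ 2 (weight-combine A B C hs)) ⟩
  (2 ℕ.* ℤ.∣ x ∣ ℕ.+ C) ℕ.+ 2 ℕ.* (2 ℕ.* weight xs ℕ.+ weightSum n ℕ.* C)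
    ≡⟨ solve 4 (λ x C W s → (con 2 :* x :+ C) :+ con 2 :* (con 2 :* W :+ s :* C) := con 2 :* (x :+ con 2 :* W) :+ (con 1 :+ con 2 :* s) :* C) refl ℤ.∣ x ∣ C (weight xs) (weightSum n) ⟩
  2 ℕ.* (ℤ.∣ x ∣ ℕ.+ 2 ℕ.* weight xs) ℕ.+ (1 ℕ.+ 2 ℕ.* weightSum n) ℕ.* C
    ∎
  where
  open ℕP.≤-Reasoning
  open ℕ-Solver

shrink-inequality : ∀ p P Z X C Y → p ℕ.≤ P → Z ℕ.* P ℕ.≤ X ℕ.+ C ℕ.* Y → 2 ℕ.* C ℕ.< p ℕ.* P →
                    2 ℕ.* P ℕ.* Z ℕ.+ Y ℕ.≤ 2 ℕ.* X ℕ.+ P ℕ.* P ℕ.* Y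
shrink-inequality p P Z X C Y p≤P ZP≤X+CY 2C<pP = begin
  2 ℕ.* P ℕ.* Z ℕ.+ Y             ≡⟨ solve 3 (λ P Z Y → con 2 :* P :* Z :+ Y := con 2 :* (Z :* P) :+ Y) refl P Z Y ⟩
  2 ℕ.* (Z ℕ.* P) ℕ.+ Y           ≤⟨ ℕP.+-monoˡ-≤ Y (ℕP.*-monoʳ-≤ 2 ZP≤X+CY) ⟩
  2 ℕ.* (X ℕ.+ C ℕ.* Y) ℕ.+ Y     ≡⟨ solve 3 (λ X C Y → con 2 :* (X :+ C :* Y) :+ Y := con 2 :* X :+ (con 1 :+ con 2 :* C) :* Y) refl X C Y ⟩
  2 ℕ.* X ℕ.+ suc (2 ℕ.* C) ℕ.* Y ≤⟨ ℕP.+-monoʳ-≤ (2 ℕ.* X) (ℕP.*-monoˡ-≤ Y (ℕP.≤-trans 2C<pP (ℕP.*-monoˡ-≤ P p≤P))) ⟩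
  2 ℕ.* X ℕ.+ P ℕ.* P ℕ.* Y       ∎
  where
  open ℕP.≤-Reasoning
  open ℕ-Solver

descent-inequality : ∀ P Y X Z s → 2 ℕ.≤ P → 1 ℕ.≤ Y → 1 ℕ.≤ s →
                     2 ℕ.* P ℕ.* Z ℕ.+ s ℕ.* Y ℕ.≤ 2 ℕ.* X ℕ.+ s ℕ.* (P ℕ.* P ℕ.* Y) →
                     Y ℕ.+ 2 ℕ.* Z ℕ.< X ℕ.+ (1 ℕ.+ s) ℕ.* (P ℕ.* Y)
descent-inequality P Y X Z s 2≤P 1≤Y 1≤s H = ℕP.*-cancelˡ-< (2 ℕ.* P) _ _ (ℕP.+-cancelʳ-< (2 ℕ.* s ℕ.* Y) _ _ (begin-strict
  2 ℕ.* P ℕ.* (Y ℕ.+ 2 ℕ.* Z) ℕ.+ 2 ℕ.* s ℕ.* Y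
    ≡⟨ solve 4 (λ P Y Z s → con 2 :* P :* (Y :+ con 2 :* Z) :+ con 2 :* s :* Y := con 2 :* P :* Y :+ con 2 :* (con 2 :* P :* Z :+ s :* Y)) refl P Y Z s ⟩
  2 ℕ.* P ℕ.* Y ℕ.+ 2 ℕ.* (2 ℕ.* P ℕ.* Z ℕ.+ s ℕ.* Y)
    ≤⟨ ℕP.+-monoʳ-≤ (2 ℕ.* P ℕ.* Y) (ℕP.*-monoʳ-≤ 2 H) ⟩
  2 ℕ.* P ℕ.* Y ℕ.+ 2 ℕ.* (2 ℕ.* X ℕ.+ s ℕ.* (P ℕ.* P ℕ.* Y))
    ≡⟨ solve 4 (λ P Y X s → con 2 :* P :* Y :+ con 2 :* (con 2 :* X :+ s :* (P :* P :* Y)) := (con 2 :* P :* Y :+ con 2 :* con 2 :* X) :+ con 2 :* s :* (P :* P :* Y)) refl P Y X s ⟩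
  (2 ℕ.* P ℕ.* Y ℕ.+ 2 ℕ.* 2 ℕ.* X) ℕ.+ 2 ℕ.* s ℕ.* (P ℕ.* P ℕ.* Y)
    <⟨ ℕP.+-monoˡ-< (2 ℕ.* s ℕ.* (P ℕ.* P ℕ.* Y)) small-terms ⟩
  ((2 ℕ.* P ℕ.* P ℕ.* Y ℕ.+ 2 ℕ.* P ℕ.* X) ℕ.+ 2 ℕ.* s ℕ.* Y) ℕ.+ 2 ℕ.* s ℕ.* (P ℕ.* P ℕ.* Y)
    ≡⟨ solve 4 (λ P Y X s → ((con 2 :* P :* P :* Y :+ con 2 :* P :* X) :+ con 2 :* s :* Y) :+ con 2 :* s :* (P :* P :* Y) := con 2 :* P :* (X :+ (con 1 :+ s) :* (P :* Y)) :+ con 2 :* s :* Y) refl P Y X s ⟩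
  2 ℕ.* P ℕ.* (X ℕ.+ (1 ℕ.+ s) ℕ.* (P ℕ.* Y)) ℕ.+ 2 ℕ.* s ℕ.* Y
    ∎))
  where
  open ℕP.≤-Reasoning
  open ℕ-Solver
  small-terms : 2 ℕ.* P ℕ.* Y ℕ.+ 2 ℕ.* 2 ℕ.* X ℕ.< (2 ℕ.* P ℕ.* P ℕ.* Y ℕ.+ 2 ℕ.* P ℕ.* X) ℕ.+ 2 ℕ.* s ℕ.* Y
  small-terms = begin-strict
    2 ℕ.* P ℕ.* Y ℕ.+ 2 ℕ.* 2 ℕ.* X
      ≤⟨ ℕP.+-mono-≤ (ℕP.*-monoˡ-≤ Y (ℕP.m≤m*n (2 ℕ.* P) P {{ℕ.>-nonZero (ℕP.≤-trans (s≤s z≤n) 2≤P)}})) (ℕP.*-monoˡ-≤ X (ℕP.*-monoʳ-≤ 2 2≤P)) ⟩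
    2 ℕ.* P ℕ.* P ℕ.* Y ℕ.+ 2 ℕ.* P ℕ.* X
      <⟨ ℕP.m<m+n _ (ℕP.*-mono-≤ (ℕP.*-mono-≤ (s≤s (z≤n {1})) 1≤s) 1≤Y) ⟩
    (2 ℕ.* P ℕ.* P ℕ.* Y ℕ.+ 2 ℕ.* P ℕ.* X) ℕ.+ 2 ℕ.* s ℕ.* Y
      ∎

2∣r-n∣<n : ∀ r n → r ℕ.< n → n ℕ.< 2 ℕ.* r → 2 ℕ.* ℤ.∣ + r ℤ.- + n ∣ ℕ.< n
2∣r-n∣<n r n r<n n<2r = subst (λ w → 2 ℕ.* w ℕ.< n) (sym ∣r-n∣≡e) 2e<n
  where
  e = n ℕ.∸ r
  r+e≡n : r ℕ.+ e ≡ n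
  r+e≡n = ℕP.m+[n∸m]≡n (ℕP.<⇒≤ r<n)
  e<r : e ℕ.< r
  e<r = ℕP.+-cancelˡ-< r e r (subst (ℕ._< r ℕ.+ r) (sym r+e≡n) (subst (n ℕ.<_) (cong (r ℕ.+_) (ℕP.+-identityʳ r)) n<2r))
  ∣r-n∣≡e : ℤ.∣ + r ℤ.- + n ∣ ≡ e
  ∣r-n∣≡e = trans (cong ℤ.∣_∣ (ℤP.m-n≡m⊖n r n)) (ℤP.∣⊖∣-≤ (ℕP.<⇒≤ r<n))
  2e<n : 2 ℕ.* e ℕ.< n
  2e<n = subst (2 ℕ.* e ℕ.<_) (trans (ℕP.+-comm e r) r+e≡n)
    (subst (ℕ._< e ℕ.+ r) (cong (e ℕ.+_) (sym (ℕP.+-identityʳ e))) (ℕP.+-monoʳ-< e e<r))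

module PAdic (p : ℕ) (p-prime : Prime p) where

  open ≡-Reasoning


  instance
    p-nonZero : NonZero p
    p-nonZero = prime⇒nonZero p-prime

  1<p : 1 ℕ.< p
  1<p = ℕ.nonTrivial⇒n>1 p {{prime⇒nonTrivial p-prime}}

  p∤1 : p ∤ 1
  p∤1 p∣1 = ℕP.<⇒≢ 1<p (sym (ℕ∣.∣1⇒≡1 p∣1))

  record ℤₚ (x : ℚ) : Set where
    constructor frac
    field
      numer denom : ℤ
      p∤denom     : p ∤ ℤ.∣ denom ∣
      frac-eq     : x * ι denom ≡ ι numer

  record pℤₚ (x : ℚ) : Set where
    constructor frac
    field
      numer denom : ℤ
      p∤denom     : p ∤ ℤ.∣ denom ∣
      frac-eq     : x * ι denom ≡ ι (+ p ℤ.* numer)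

  p∣∣i*j∣⇒p∣∣i∣ : ∀ i j → p ∣ ℤ.∣ i ℤ.* j ∣ → p ∤ ℤ.∣ j ∣ → p ∣ ℤ.∣ i ∣
  p∣∣i*j∣⇒p∣∣i∣ i j p∣ij p∤j with euclidsLemma ℤ.∣ i ∣ ℤ.∣ j ∣ p-prime (subst (p ∣_) (ℤP.abs-* i j) p∣ij)
  ... | inj₁ p∣i = p∣i
  ... | inj₂ p∣j = ⊥-elim (p∤j p∣j)

  p∤∣i*j∣ : ∀ i j → p ∤ ℤ.∣ i ∣ → p ∤ ℤ.∣ j ∣ → p ∤ ℤ.∣ i ℤ.* j ∣
  p∤∣i*j∣ i j p∤i p∤j p∣ij = p∤i (p∣∣i*j∣⇒p∣∣i∣ i j p∣ij p∤j)

  ∣i∣∣∣j∣⇒∣∣i*j∣ : ∀ {d} i j → d ∣ ℤ.∣ i ∣ → d ∣ ℤ.∣ i ℤ.* j ∣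
  ∣i∣∣∣j∣⇒∣∣i*j∣ i j d∣i = subst (_ ∣_) (sym (ℤP.abs-* i j)) (ℕ∣.∣m⇒∣m*n ℤ.∣ j ∣ d∣i)

  ∣∣j∣⇒∣∣i*j∣ : ∀ {d} i j → d ∣ ℤ.∣ j ∣ → d ∣ ℤ.∣ i ℤ.* j ∣
  ∣∣j∣⇒∣∣i*j∣ i j d∣j = subst (_ ∣_) (sym (ℤP.abs-* i j)) (ℕ∣.∣n⇒∣m*n ℤ.∣ i ∣ d∣j)

  ↥↧-coprime : ∀ x → Coprimality.Coprime ℤ.∣ ↥ x ∣ (↧ₙ x)
  ↥↧-coprime (mkℚ _ _ c) = Coprimality.recompute c

  ℤₚ⇒p∤↧ : ∀ {x} → ℤₚ x → p ∤ ↧ₙ x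
  ℤₚ⇒p∤↧ {x} (frac a b p∤b e) p∣↧x = ℕP.<⇒≢ 1<p (sym (↥↧-coprime x (p∣↥x , p∣↧x)))
    where
    p∣↥x : p ∣ ℤ.∣ ↥ x ∣
    p∣↥x = p∣∣i*j∣⇒p∣∣i∣ (↥ x) b (subst (λ w → p ∣ ℤ.∣ w ∣) (sym (↥*≡*↧ x a b e)) (∣∣j∣⇒∣∣i*j∣ a (↧ x) p∣↧x)) p∤b

  p∤↧⇒ℤₚ : ∀ {x} → p ∤ ↧ₙ x → ℤₚ x
  p∤↧⇒ℤₚ {x} p∤↧x = frac (↥ x) (↧ x) p∤↧x (*-ι-↧ x)

  pℤₚ⇒ℤₚ : ∀ {x} → pℤₚ x → ℤₚ x
  pℤₚ⇒ℤₚ (frac a b p∤b e) = frac (+ p ℤ.* a) b p∤b e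

  pℤₚ⇒p∣↥ : ∀ {x} → pℤₚ x → p ∣ ℤ.∣ ↥ x ∣
  pℤₚ⇒p∣↥ {x} (frac a b p∤b e) = p∣∣i*j∣⇒p∣∣i∣ (↥ x) b
    (subst (λ w → p ∣ ℤ.∣ w ∣) (sym (↥*≡*↧ x (+ p ℤ.* a) b e))
      (∣i∣∣∣j∣⇒∣∣i*j∣ (+ p ℤ.* a) (↧ x) (∣i∣∣∣j∣⇒∣∣i*j∣ (+ p) a ℕ∣.∣-refl)))
    p∤b

  ℤₚ∧p∣↥⇒pℤₚ : ∀ {x} → ℤₚ x → p ∣ ℤ.∣ ↥ x ∣ → pℤₚ x
  ℤₚ∧p∣↥⇒pℤₚ {x} x∈ℤₚ p∣↥x with ℤ∣.∣ᵤ⇒∣ {+ p} {↥ x} p∣↥x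
  ... | ℤ∣.divides q ↥x≡q*p =
    frac q (↧ x) (ℤₚ⇒p∤↧ x∈ℤₚ) (trans (*-ι-↧ x) (cong ι (trans ↥x≡q*p (ℤP.*-comm q (+ p)))))

  ι∈ℤₚ : ∀ c → ℤₚ (ι c)
  ι∈ℤₚ c = frac c (+ 1) p∤1 (trans (cong (ι c *_) ι-1) (ℚP.*-identityʳ (ι c)))

  ℤₚ-− : ∀ {x y} → ℤₚ x → ℤₚ y → ℤₚ (x - y)
  ℤₚ-− {x} {y} (frac a₁ b₁ p∤b₁ e₁) (frac a₂ b₂ p∤b₂ e₂) =
    frac (a₁ ℤ.* b₂ ℤ.- a₂ ℤ.* b₁) (b₁ ℤ.* b₂) (p∤∣i*j∣ b₁ b₂ p∤b₁ p∤b₂) (begin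
      (x - y) * ι (b₁ ℤ.* b₂)                  ≡⟨ cong ((x - y) *_) (ι-homo-* b₁ b₂) ⟩
      (x - y) * (ι b₁ * ι b₂)                  ≡⟨ solve 4 (λ x y u v → (x :- y) :* (u :* v) := (x :* u) :* v :- (y :* v) :* u) refl x y (ι b₁) (ι b₂) ⟩
      (x * ι b₁) * ι b₂ - (y * ι b₂) * ι b₁    ≡⟨ cong₂ (λ s t → s * ι b₂ - t * ι b₁) e₁ e₂ ⟩
      ι a₁ * ι b₂ - ι a₂ * ι b₁                ≡⟨ cong₂ _-_ (ι-homo-* a₁ b₂) (ι-homo-* a₂ b₁) ⟨
      ι (a₁ ℤ.* b₂) - ι (a₂ ℤ.* b₁)            ≡⟨ ι-homo-− (a₁ ℤ.* b₂) (a₂ ℤ.* b₁) ⟨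
      ι (a₁ ℤ.* b₂ ℤ.- a₂ ℤ.* b₁)              ∎)
    where open ℚ-Solver

  pℤₚ-*-ι : ∀ {x} y → pℤₚ x → pℤₚ (x * ι y)
  pℤₚ-*-ι {x} y (frac a b p∤b e) = frac (a ℤ.* y) b p∤b (begin
    x * ι y * ι b            ≡⟨ solve 3 (λ x y b → x :* y :* b := (x :* b) :* y) refl x (ι y) (ι b) ⟩
    (x * ι b) * ι y          ≡⟨ cong (_* ι y) e ⟩
    ι (+ p ℤ.* a) * ι y      ≡⟨ ι-homo-* (+ p ℤ.* a) y ⟨
    ι (+ p ℤ.* a ℤ.* y)      ≡⟨ cong ι (ℤP.*-assoc (+ p) a y) ⟩
    ι (+ p ℤ.* (a ℤ.* y))    ∎)
    where open ℚ-Solver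

  p∤d⇒coprime : ∀ d → p ∤ d → Coprimality.Coprime p d
  p∤d⇒coprime d p∤d {i} (i∣p , i∣d) with prime⇒irreducible p-prime i∣p
  ... | inj₁ i≡1 = i≡1
  ... | inj₂ refl = ⊥-elim (p∤d i∣d)

  ∣p^k∧p∤⇒≡1 : ∀ k d → d ∣ p ^ k → p ∤ d → d ≡ 1
  ∣p^k∧p∤⇒≡1 zero    d d∣1   _   = ℕ∣.∣1⇒≡1 d∣1
  ∣p^k∧p∤⇒≡1 (suc k) d d∣p^k p∤d =
    ∣p^k∧p∤⇒≡1 k d (Coprimality.coprime-divisor (Coprimality.sym (p∤d⇒coprime d p∤d)) d∣p^k) p∤d

  ℤₚ∧p^k-multiple∈ℤ⇒∈ℤ : ∀ {g} k w → ℤₚ g → g * ι (+ (p ^ k)) ≡ ι w → Σ ℤ λ z → g ≡ ι z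
  ℤₚ∧p^k-multiple∈ℤ⇒∈ℤ {g} k w g∈ℤₚ e = ↥ g , (begin
    g                  ≡⟨ ℚP.*-identityʳ g ⟨
    g * 1ℚ             ≡⟨ cong (g *_) ι-1 ⟨
    g * ι (+ 1)        ≡⟨ cong (λ n → g * ι (+ n)) ↧g≡1 ⟨
    g * ι (↧ g)        ≡⟨ *-ι-↧ g ⟩
    ι (↥ g)            ∎)
    where
    ↧g∣↥g*p^k : ↧ₙ g ∣ ℤ.∣ ↥ g ∣ ℕ.* p ^ k
    ↧g∣↥g*p^k = subst (↧ₙ g ∣_) (trans (cong ℤ.∣_∣ (sym (↥*≡*↧ g w (+ (p ^ k) ) e))) (ℤP.abs-* (↥ g) (+ (p ^ k))))
      (∣∣j∣⇒∣∣i*j∣ w (↧ g) ℕ∣.∣-refl)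
    ↧g≡1 : ↧ₙ g ≡ 1
    ↧g≡1 = ∣p^k∧p∤⇒≡1 k (↧ₙ g) (Coprimality.coprime-divisor (Coprimality.sym (↥↧-coprime g)) ↧g∣↥g*p^k) (ℤₚ⇒p∤↧ g∈ℤₚ)

  record Factorisation (n : ℕ) : Set where
    constructor factors
    field
      exponent unit : ℕ
      n≡p^e*u       : n ≡ p ^ exponent ℕ.* unit
      p∤unit        : p ∤ unit
      exponent≤n    : exponent ℕ.≤ n

  factorise : ∀ n .{{_ : NonZero n}} → Factorisation n
  factorise n = go n (<-wellFounded n)
    where
    go : ∀ n .{{_ : NonZero n}} → Acc ℕ._<_ n → Factorisation n
    go n (acc rec) with p ∣? n
    ... | no p∤n = factors 0 n (sym (ℕP.+-identityʳ n)) p∤n z≤n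
    ... | yes (divides q n≡q*p) = factors (suc e) u n≡ p∤u (ℕP.≤-trans (s≤s e≤q) q<n)
      where
      instance
        q-nonZero : NonZero q
        q-nonZero = ℕ.≢-nonZero λ q≡0 → ℕ.≢-nonZero⁻¹ n (trans n≡q*p (cong (ℕ._* p) q≡0))
      q<n : q ℕ.< n
      q<n = subst (q ℕ.<_) (sym n≡q*p) (ℕP.m<m*n q p 1<p)
      open Factorisation (go q (rec q<n)) renaming (exponent to e; unit to u; n≡p^e*u to q≡; p∤unit to p∤u; exponent≤n to e≤q)
      n≡ : n ≡ p ^ suc e ℕ.* u
      n≡ = trans n≡q*p (trans (cong (ℕ._* p) q≡) (trans (ℕP.*-comm (p ^ e ℕ.* u) p) (sym (ℕP.*-assoc p (p ^ e) u))))

  record PositiveValuation (z : ℤ) : Set where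
    constructor valuation
    field
      exponent-1 : ℕ
      cofactor   : ℤ
      z≡p^e*y    : z ≡ + (p ^ suc exponent-1) ℤ.* cofactor
      p∤cofactor : p ∤ ℤ.∣ cofactor ∣

  p∣⇒positiveValuation : ∀ z → z ≢ + 0 → p ∣ ℤ.∣ z ∣ → PositiveValuation z
  p∣⇒positiveValuation z z≢0 p∣z with factorise ℤ.∣ z ∣ {{ℕ.≢-nonZero (z≢0 ∘ ℤP.∣i∣≡0⇒i≡0)}}
  ... | factors zero    u ∣z∣≡u p∤u _ = ⊥-elim (p∤u (subst (p ∣_) (trans ∣z∣≡u (ℕP.+-identityʳ u)) p∣z))
  ... | factors (suc e) u ∣z∣≡pᵉu p∤u _ = valuation e (ℤ.sign z ℤ.◃ u) z≡ (subst (p ∤_) (sym (ℤP.abs-◃ (ℤ.sign z) u)) p∤u)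
    where
    z≡ : z ≡ + (p ^ suc e) ℤ.* (ℤ.sign z ℤ.◃ u)
    z≡ = begin
      z                                          ≡⟨ ℤP.◃-inverse z ⟨
      ℤ.sign z ℤ.◃ ℤ.∣ z ∣                       ≡⟨ cong (ℤ.sign z ℤ.◃_) ∣z∣≡pᵉu ⟩
      ℤ.sign z ℤ.◃ (p ^ suc e ℕ.* u)             ≡⟨ ℤP.◃-distrib-* Sign.+ (ℤ.sign z) (p ^ suc e) u ⟩
      (Sign.+ ℤ.◃ p ^ suc e) ℤ.* (ℤ.sign z ℤ.◃ u) ≡⟨ cong (ℤ._* (ℤ.sign z ℤ.◃ u)) (ℤP.+◃n≡+n (p ^ suc e)) ⟩
      + (p ^ suc e) ℤ.* (ℤ.sign z ℤ.◃ u)          ∎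

module BalancedDigit (p : ℕ) (p-prime : Prime p) (p≢2 : p ≢ 2) where

  open ≡-Reasoning

  open PAdic p p-prime
  open import Data.Nat.GCD using (module Bézout)
  open import Data.Integer.DivMod using (_%ℕ_; _/ℕ_; a≡a%ℕn+[a/ℕn]*n; n%ℕd<d)
  open import Data.List using ([]; _∷_; filter)
  open import Data.List.Membership.Propositional using (_∈_)
  open import Data.List.Membership.Propositional.Properties using (∈-map⁺; ∈-filter⁺; ∈-filter⁻; ∈-upTo⁺)
  open import Data.List.Relation.Unary.Any using (here)

  2∤p : 2 ∤ p
  2∤p 2∣p with prime⇒irreducible p-prime 2∣p
  ... | inj₁ ()
  ... | inj₂ 2≡p = p≢2 (sym 2≡p)

  inverse-mod-p : ∀ d → p ∤ d → Σ ℤ λ u → + p ℤ∣.∣ (u ℤ.* + d ℤ.- + 1)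
  inverse-mod-p d p∤d with Coprimality.coprime-Bézout (p∤d⇒coprime d p∤d)
  ... | Bézout.+- x y 1+yd≡xp = ℤ.- + y , ℤ∣.divides (ℤ.- + x) (begin
    ℤ.- + y ℤ.* + d ℤ.- + 1      ≡⟨ solve 2 (λ y d → :- y :* d :- con (+ 1) := :- (con (+ 1) :+ y :* d)) refl (+ y) (+ d) ⟩
    ℤ.- (+ 1 ℤ.+ + y ℤ.* + d)    ≡⟨ cong (λ w → ℤ.- (+ 1 ℤ.+ w)) (ℤP.pos-* y d) ⟨
    ℤ.- + (1 ℕ.+ y ℕ.* d)        ≡⟨ cong (λ w → ℤ.- + w) 1+yd≡xp ⟩
    ℤ.- + (x ℕ.* p)              ≡⟨ cong ℤ.-_ (ℤP.pos-* x p) ⟩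
    ℤ.- (+ x ℤ.* + p)            ≡⟨ ℤP.neg-distribˡ-* (+ x) (+ p) ⟩
    ℤ.- + x ℤ.* + p              ∎)
    where open ℤ-Solver
  ... | Bézout.-+ x y 1+xp≡yd = + y , ℤ∣.divides (+ x) (begin
    + y ℤ.* + d ℤ.- + 1          ≡⟨ cong (ℤ._- + 1) (ℤP.pos-* y d) ⟨
    + (y ℕ.* d) ℤ.- + 1          ≡⟨ cong (λ w → + w ℤ.- + 1) 1+xp≡yd ⟨
    + (1 ℕ.+ x ℕ.* p) ℤ.- + 1    ≡⟨ cong (λ w → + 1 ℤ.+ w ℤ.- + 1) (ℤP.pos-* x p) ⟩
    + 1 ℤ.+ + x ℤ.* + p ℤ.- + 1  ≡⟨ solve 2 (λ x p → con (+ 1) :+ x :* p :- con (+ 1) := x :* p) refl (+ x) (+ p) ⟩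
    + x ℤ.* + p                  ∎)
    where open ℤ-Solver

  +i-p∈balancedDigits : ∀ {i} → i ℕ.< suc (2 ℕ.* p) → 2 ℕ.* ℤ.∣ + i ℤ.- + p ∣ ℕ.< p → + i ℤ.- + p ∈ balancedDigits p
  +i-p∈balancedDigits i<2p+1 small =
    ∈-filter⁺ (λ c → 2 ℕ.* ℤ.∣ c ∣ ℕ.<? p) (∈-map⁺ (λ i → + i ℤ.- + p) (∈-upTo⁺ i<2p+1)) small

  balancedDigits-small : ∀ {c} → c ∈ balancedDigits p → 2 ℕ.* ℤ.∣ c ∣ ℕ.< p
  balancedDigits-small = proj₂ ∘ ∈-filter⁻ (λ c → 2 ℕ.* ℤ.∣ c ∣ ℕ.<? p)

  balanced-residue : ∀ t → Σ ℤ λ c → c ∈ balancedDigits p × + p ℤ∣.∣ (t ℤ.- c)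
  balanced-residue t with 2 ℕ.* r ℕ.<? p
    where r = t %ℕ p
  ... | yes 2r<p = + r , subst (_∈ balancedDigits p) +r+p-p≡+r (+i-p∈balancedDigits r+p<2p+1 (subst (λ c → 2 ℕ.* ℤ.∣ c ∣ ℕ.< p) (sym +r+p-p≡+r) 2r<p))
                 , ℤ∣.divides q (trans (cong (ℤ._- + r) (a≡a%ℕn+[a/ℕn]*n t p)) (solve 2 (λ r w → r :+ w :- r := w) refl (+ r) (q ℤ.* + p)))
    where
    open ℤ-Solver
    r = t %ℕ p
    q = t /ℕ p
    +r+p-p≡+r : + (r ℕ.+ p) ℤ.- + p ≡ + r
    +r+p-p≡+r = trans (cong (ℤ._- + p) (ℤP.pos-+ r p)) (solve 2 (λ r p → (r :+ p) :- p := r) refl (+ r) (+ p))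
    r+p<2p+1 : r ℕ.+ p ℕ.< suc (2 ℕ.* p)
    r+p<2p+1 = s≤s (subst (r ℕ.+ p ℕ.≤_) (cong (p ℕ.+_) (sym (ℕP.+-identityʳ p))) (ℕP.+-monoˡ-≤ p (ℕP.<⇒≤ (n%ℕd<d t p))))
  ... | no 2r≮p = + r ℤ.- + p , +i-p∈balancedDigits r<2p+1 small
                 , ℤ∣.divides (q ℤ.+ + 1) (trans (cong (ℤ._- (+ r ℤ.- + p)) (a≡a%ℕn+[a/ℕn]*n t p))
                     (solve 3 (λ r q p → r :+ q :* p :- (r :- p) := (q :+ con (+ 1)) :* p) refl (+ r) q (+ p)))
    where
    open ℤ-Solver
    r = t %ℕ p
    q = t /ℕ p
    r<p : r ℕ.< p
    r<p = n%ℕd<d t p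
    r<2p+1 : r ℕ.< suc (2 ℕ.* p)
    r<2p+1 = s≤s (ℕP.≤-trans (ℕP.<⇒≤ r<p) (ℕP.m≤m+n p _))
    p<2r : p ℕ.< 2 ℕ.* r
    p<2r = ℕP.≤∧≢⇒< (ℕP.≮⇒≥ 2r≮p) (λ p≡2r → 2∤p (divides r (trans p≡2r (ℕP.*-comm 2 r))))
    small : 2 ℕ.* ℤ.∣ + r ℤ.- + p ∣ ℕ.< p
    small = 2∣r-n∣<n r p r<p p<2r

  balanced-digit-exists : ∀ x → ℤₚ x → Σ ℤ λ c → c ∈ balancedDigits p × pℤₚ (x - ι c)
  balanced-digit-exists x x∈ℤₚ = c , c∈digits , frac w D p∤D (begin
    (x - ι c) * ι D      ≡⟨ solve 3 (λ x c d → (x :- c) :* d := x :* d :- c :* d) refl x (ι c) (ι D) ⟩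
    x * ι D - ι c * ι D  ≡⟨ cong₂ _-_ (*-ι-↧ x) (sym (ι-homo-* c D)) ⟩
    ι X - ι (c ℤ.* D)    ≡⟨ ι-homo-− X (c ℤ.* D) ⟨
    ι (X ℤ.- c ℤ.* D)    ≡⟨ cong ι (trans (ℤ∣._∣_.equality p∣X-cD) (ℤP.*-comm w (+ p))) ⟩
    ι (+ p ℤ.* w)        ∎)
    where
    open ℚ-Solver
    D = ↧ x
    X = ↥ x
    p∤D = ℤₚ⇒p∤↧ x∈ℤₚ
    U = proj₁ (inverse-mod-p (↧ₙ x) p∤D)
    c = proj₁ (balanced-residue (X ℤ.* U))
    c∈digits = proj₁ (proj₂ (balanced-residue (X ℤ.* U)))
    -- c ≡ X / D (mod p), because U inverts D modulo p
    p∣X-cD : + p ℤ∣.∣ (X ℤ.- c ℤ.* D)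
    p∣X-cD = subst (+ p ℤ∣.∣_)
      (ℤ-Solver.solve 4 (λ X U D c → ℤ-Solver.:- X ℤ-Solver.:* (U ℤ-Solver.:* D ℤ-Solver.:- ℤ-Solver.con (+ 1)) ℤ-Solver.:+ (X ℤ-Solver.:* U ℤ-Solver.:- c) ℤ-Solver.:* D ℤ-Solver.:= X ℤ-Solver.:- c ℤ-Solver.:* D) refl X U D c)
      (ℤ∣.∣m∣n⇒∣m+n (ℤ∣.∣n⇒∣m*n (ℤ.- X) (proj₂ (inverse-mod-p (↧ₙ x) p∤D)))
                    (ℤ∣.∣m⇒∣m*n D (proj₂ (proj₂ (balanced-residue (X ℤ.* U))))))
    w = ℤ∣._∣_.quotient p∣X-cD

  candidate-exists : ∀ x → ℤₚ x → Σ ℤ λ c → c ∈ filter (λ c → p ∣? ℤ.∣ ↥ (x - (c ℚ./ 1)) ∣) (balancedDigits p)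
  candidate-exists x x∈ℤₚ = c , ∈-filter⁺ (λ c → p ∣? ℤ.∣ ↥ (x - (c ℚ./ 1)) ∣) c∈digits p∣x-c
    where
    c : ℤ
    c = proj₁ (balanced-digit-exists x x∈ℤₚ)
    c∈digits : c ∈ balancedDigits p
    c∈digits = proj₁ (proj₂ (balanced-digit-exists x x∈ℤₚ))
    p∣x-c : p ∣ ℤ.∣ ↥ (x - (c ℚ./ 1)) ∣
    p∣x-c = subst (λ w → p ∣ ℤ.∣ ↥ (x - w) ∣) (ι-def c) (pℤₚ⇒p∣↥ (proj₂ (proj₂ (balanced-digit-exists x x∈ℤₚ))))

  digit0-spec : ∀ x → ℤₚ x → 2 ℕ.* ℤ.∣ digit0 p x ∣ ℕ.< p × pℤₚ (x - ι (digit0 p x))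
  digit0-spec x x∈ℤₚ with filter (λ c → p ∣? ℤ.∣ ↥ (x - (c ℚ./ 1)) ∣) (balancedDigits p) in eq
  ... | [] = ⊥-elim (no-candidate (proj₂ (candidate-exists x x∈ℤₚ)))
    where
    no-candidate : ∀ {c} → c ∈ filter (λ c → p ∣? ℤ.∣ ↥ (x - (c ℚ./ 1)) ∣) (balancedDigits p) → ⊥
    no-candidate c∈ rewrite eq with c∈
    ... | ()
  digit0-spec x x∈ℤₚ | c ∷ _ =
    balancedDigits-small c∈digits , ℤₚ∧p∣↥⇒pℤₚ (ℤₚ-− x∈ℤₚ (ι∈ℤₚ c)) (subst (λ w → p ∣ ℤ.∣ ↥ (x - w) ∣) (sym (ι-def c)) p∣x-c)
    where
    c∈filtered = ∈-filter⁻ (λ c → p ∣? ℤ.∣ ↥ (x - (c ℚ./ 1)) ∣) {xs = balancedDigits p} (subst (c ∈_) (sym eq) (here refl))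
    c∈digits = proj₁ c∈filtered
    p∣x-c = proj₂ c∈filtered

module Browkin (p : ℕ) (p-prime : Prime p) (p≢2 : p ≢ 2) where

  open ≡-Reasoning

  open PAdic p p-prime
  open BalancedDigit p p-prime p≢2

  π : ℚ
  π = ι (+ p)

  π⁻¹ : ℚ
  π⁻¹ = + 1 ℚ./ p

  π⁻¹*π≡1 : π⁻¹ * π ≡ 1ℚ
  π⁻¹*π≡1 = trans (/-*-ι (+ 1) p) ι-1

  π*[x*π⁻¹]≡x : ∀ x → π * (x * π⁻¹) ≡ x
  π*[x*π⁻¹]≡x x = trans (solve 3 (λ π x v → π :* (x :* v) := x :* (v :* π)) refl π x π⁻¹)
                        (trans (cong (x *_) π⁻¹*π≡1) (ℚP.*-identityʳ x))
    where open ℚ-Solver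

  π*-cancel : ∀ {x y} → π * x ≡ π * y → x ≡ y
  π*-cancel {x} {y} πx≡πy = begin
    x                ≡⟨ ℚP.*-identityˡ x ⟨
    1ℚ * x           ≡⟨ cong (_* x) π⁻¹*π≡1 ⟨
    π⁻¹ * π * x      ≡⟨ ℚP.*-assoc π⁻¹ π x ⟩
    π⁻¹ * (π * x)    ≡⟨ cong (π⁻¹ *_) πx≡πy ⟩
    π⁻¹ * (π * y)    ≡⟨ ℚP.*-assoc π⁻¹ π y ⟨
    π⁻¹ * π * y      ≡⟨ cong (_* y) π⁻¹*π≡1 ⟩
    1ℚ * y           ≡⟨ ℚP.*-identityˡ y ⟩
    y                ∎

  ι-p^suc : ∀ k → ι (+ (p ^ suc k)) ≡ π * ι (+ (p ^ k))
  ι-p^suc k = trans (cong ι (ℤP.pos-* p (p ^ k))) (ι-homo-* (+ p) (+ (p ^ k)))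

  ℤₚ-p^suc : ∀ k α → ℤₚ (ι (+ (p ^ suc k)) * α) → ℤₚ (ι (+ (p ^ k)) * ((+ p ℚ./ 1) * α))
  ℤₚ-p^suc k α = subst ℤₚ (begin
    ι (+ (p ^ suc k)) * α       ≡⟨ cong (_* α) (ι-p^suc k) ⟩
    π * ι (+ (p ^ k)) * α       ≡⟨ solve 3 (λ π P a → (π :* P) :* a := P :* (π :* a)) refl π (ι (+ (p ^ k))) α ⟩
    ι (+ (p ^ k)) * (π * α)     ≡⟨ cong (λ w → ι (+ (p ^ k)) * (w * α)) (ι-def (+ p)) ⟩
    ι (+ (p ^ k)) * ((+ p ℚ./ 1) * α) ∎)
    where open ℚ-Solver

  ℤₚ-p^0 : ∀ {α} → ℤₚ (ι (+ (p ^ 0)) * α) → ℤₚ α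
  ℤₚ-p^0 {α} = subst ℤₚ (trans (cong (_* α) ι-1) (ℚP.*-identityˡ α))

  record BrowkinApprox (α : ℚ) (k : ℕ) (a : ℚ) : Set where
    constructor approx
    field
      scaled       : ℤ
      scaled-eq    : a * ι (+ (p ^ k)) ≡ ι scaled
      scaled-small : 2 ℕ.* ℤ.∣ scaled ∣ ℕ.< p ^ suc k
      remainder    : pℤₚ (α - a)

  digit0-approx : ∀ {α} k → ℤₚ α → BrowkinApprox α k (ι (digit0 p α))
  digit0-approx {α} k α∈ℤₚ = approx (c ℤ.* + (p ^ k)) (sym (ι-homo-* c (+ (p ^ k)))) small (proj₂ (digit0-spec α α∈ℤₚ))
    where
    c = digit0 p α
    small : 2 ℕ.* ℤ.∣ c ℤ.* + (p ^ k) ∣ ℕ.< p ^ suc k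
    small = subst (ℕ._< p ^ suc k) (trans (ℕP.*-assoc 2 ℤ.∣ c ∣ (p ^ k)) (cong (2 ℕ.*_) (sym (ℤP.abs-* c (+ (p ^ k))))))
              (ℕP.*-monoˡ-< (p ^ k) {{ℕP.m^n≢0 p k}} (proj₁ (digit0-spec α α∈ℤₚ)))

  approx-step : ∀ {α k t} → BrowkinApprox (π * α) k t →
                BrowkinApprox α (suc k) (t * π⁻¹ + ι (digit0 p (α - t * π⁻¹)))
  approx-step {α} {k} {t} (approx c e c-small (frac a b p∤b πα-t≡pa/b)) =
    approx (c ℤ.+ c₀ ℤ.* P) scaled-eq (2*∣i+j*n∣<m*n c c₀ (p ^ suc k) p c-small (proj₁ digit-spec)) remainder
    where
    open ℚ-Solver
    α-t/p∈ℤₚ : ℤₚ (α - t * π⁻¹)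
    α-t/p∈ℤₚ = frac a b p∤b (π*-cancel (begin
      π * ((α - t * π⁻¹) * ι b)         ≡⟨ solve 5 (λ π α t v b → π :* ((α :- t :* v) :* b) := (π :* α :- π :* (t :* v)) :* b) refl π α t π⁻¹ (ι b) ⟩
      (π * α - π * (t * π⁻¹)) * ι b     ≡⟨ cong (λ z → (π * α - z) * ι b) (π*[x*π⁻¹]≡x t) ⟩
      (π * α - t) * ι b                 ≡⟨ πα-t≡pa/b ⟩
      ι (+ p ℤ.* a)                     ≡⟨ ι-homo-* (+ p) a ⟩
      π * ι a                           ∎))
    digit-spec = digit0-spec (α - t * π⁻¹) α-t/p∈ℤₚ
    c₀ = digit0 p (α - t * π⁻¹)
    P = + (p ^ suc k)
    Q = ι (+ (p ^ k))
    scaled-eq : (t * π⁻¹ + ι c₀) * ι P ≡ ι (c ℤ.+ c₀ ℤ.* P)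
    scaled-eq = begin
      (t * π⁻¹ + ι c₀) * ι P                 ≡⟨ cong ((t * π⁻¹ + ι c₀) *_) (ι-p^suc k) ⟩
      (t * π⁻¹ + ι c₀) * (π * Q)             ≡⟨ solve 5 (λ t v c π Q → (t :* v :+ c) :* (π :* Q) := (π :* (t :* v)) :* Q :+ c :* (π :* Q)) refl t π⁻¹ (ι c₀) π Q ⟩
      (π * (t * π⁻¹)) * Q + ι c₀ * (π * Q)   ≡⟨ cong₂ (λ a b → a * Q + ι c₀ * b) (π*[x*π⁻¹]≡x t) (sym (ι-p^suc k)) ⟩
      t * Q + ι c₀ * ι P                     ≡⟨ cong₂ _+_ e (sym (ι-homo-* c₀ P)) ⟩
      ι c + ι (c₀ ℤ.* P)                     ≡⟨ ι-homo-+ c (c₀ ℤ.* P) ⟨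
      ι (c ℤ.+ c₀ ℤ.* P)                     ∎
    remainder : pℤₚ (α - (t * π⁻¹ + ι c₀))
    remainder = subst pℤₚ (solve 3 (λ a t c → (a :- t) :- c := a :- (t :+ c)) refl α (t * π⁻¹) (ι c₀)) (proj₂ digit-spec)

  -- j bounds the p-adic valuation of the denominator of α, so fuel f ≥ j suffices.
  browkinFuel-approx : ∀ f α k j → j ℕ.≤ f → ℤₚ (ι (+ (p ^ j)) * α) → ℤₚ (ι (+ (p ^ k)) * α) →
                       BrowkinApprox α k (browkinFuel f p α)
  browkinFuel-approx zero α k zero _ pʲα∈ℤₚ _ = subst (BrowkinApprox α k) (ι-def (digit0 p α)) (digit0-approx k (ℤₚ-p^0 pʲα∈ℤₚ))
  browkinFuel-approx (suc f) α k j j≤f pʲα∈ℤₚ pᵏα∈ℤₚ with p ∣? ↧ₙ α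
  ... | no p∤↧α = subst (BrowkinApprox α k) (ι-def (digit0 p α)) (digit0-approx k (p∤↧⇒ℤₚ p∤↧α))
  browkinFuel-approx (suc f) α zero j j≤f pʲα∈ℤₚ pᵏα∈ℤₚ | yes p∣↧α = ⊥-elim (ℤₚ⇒p∤↧ (ℤₚ-p^0 pᵏα∈ℤₚ) p∣↧α)
  browkinFuel-approx (suc f) α (suc k) zero j≤f pʲα∈ℤₚ pᵏα∈ℤₚ | yes p∣↧α = ⊥-elim (ℤₚ⇒p∤↧ (ℤₚ-p^0 pʲα∈ℤₚ) p∣↧α)
  browkinFuel-approx (suc f) α (suc k) (suc j) (s≤s j≤f) pʲα∈ℤₚ pᵏα∈ℤₚ | yes p∣↧α =
    subst (λ c → BrowkinApprox α (suc k) (t * π⁻¹ + c)) (ι-def (digit0 p (α - t * π⁻¹)))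
      (approx-step (subst (λ w → BrowkinApprox (w * α) k t) (sym (ι-def (+ p))) IH))
    where
    IH = browkinFuel-approx f ((+ p ℚ./ 1) * α) k j j≤f (ℤₚ-p^suc j α pʲα∈ℤₚ) (ℤₚ-p^suc k α pᵏα∈ℤₚ)
    t = browkinFuel f p ((+ p ℚ./ 1) * α)

  s-approx : ∀ α k → ℤₚ (ι (+ (p ^ k)) * α) → BrowkinApprox α k (s p α)
  s-approx α k pᵏα∈ℤₚ = browkinFuel-approx (↧ₙ α) α k e e≤↧α pᵉα∈ℤₚ pᵏα∈ℤₚ
    where
    open Factorisation (factorise (↧ₙ α)) renaming (exponent to e; unit to d; n≡p^e*u to ↧α≡pᵉd; exponent≤n to e≤↧α)
    pᵉα∈ℤₚ : ℤₚ (ι (+ (p ^ e)) * α)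
    pᵉα∈ℤₚ = frac (↥ α) (+ d) p∤unit (begin
      ι (+ (p ^ e)) * α * ι (+ d)        ≡⟨ solve 3 (λ P a d → P :* a :* d := a :* (P :* d)) refl (ι (+ (p ^ e))) α (ι (+ d)) ⟩
      α * (ι (+ (p ^ e)) * ι (+ d))      ≡⟨ cong (α *_) (ι-homo-* (+ (p ^ e)) (+ d)) ⟨
      α * ι (+ (p ^ e) ℤ.* + d)          ≡⟨ cong (λ w → α * ι w) (trans (cong +_ ↧α≡pᵉd) (ℤP.pos-* (p ^ e) d)) ⟨
      α * ι (↧ α)                        ≡⟨ *-ι-↧ α ⟩
      ι (↥ α)                            ∎)
      where open ℚ-Solver

Numerators : ∀ {n} → ℤ → Vec ℚ n → Vec ℤ n → Set
Numerators D = Pointwise (λ a x → a * ι D ≡ ι x)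

Numerators-scale : ∀ {n D} c {α : Vec ℚ n} {xs} → Numerators D α xs → Numerators (D ℤ.* c) α (vmap (ℤ._* c) xs)
Numerators-scale {D = D} c {α} α≡xs/D =
  subst (λ β → Numerators (D ℤ.* c) β _) (VecP.map-id α) (PW.map⁺ (λ {a} {x} → *-ι-scale a D x c) α≡xs/D)

common-denominator : ∀ {n} (α : Vec ℚ n) → Σ ℕ λ D → NonZero D × Σ (Vec ℤ n) (Numerators (+ D) α)
common-denominator []      = 1 , _ , [] , []
common-denominator (a ∷ α) with common-denominator α
... | D , D-nonZero , xs , α≡xs/D =
  ↧ₙ a ℕ.* D , ℕP.m*n≢0 (↧ₙ a) D {{_}} {{D-nonZero}} , (↥ a ℤ.* + D) ∷ vmap (ℤ._* ↧ a) xs ,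
  subst (λ E → a * ι E ≡ ι (↥ a ℤ.* + D)) (sym ↧a*D) (*-ι-scale a (↧ a) (↥ a) (+ D) (*-ι-↧ a)) ∷
  subst (λ E → Numerators E α _) (sym (trans ↧a*D (ℤP.*-comm (↧ a) (+ D)))) (Numerators-scale (↧ a) α≡xs/D)
  where
  ↧a*D : + (↧ₙ a ℕ.* D) ≡ ↧ a ℤ.* + D
  ↧a*D = ℤP.pos-* (↧ₙ a) D

Pointwise-init : ∀ {a b r} {A : Set a} {B : Set b} {R : A → B → Set r} {n} {xs : Vec A (suc n)} {ys : Vec B (suc n)} →
                 Pointwise R xs ys → Pointwise R (init xs) (init ys)
Pointwise-init (r ∷ [])         = []
Pointwise-init (r ∷ rs@(_ ∷ _)) = r ∷ Pointwise-init rs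

Pointwise-last : ∀ {a b r} {A : Set a} {B : Set b} {R : A → B → Set r} {n} {xs : Vec A (suc n)} {ys : Vec B (suc n)} →
                 Pointwise R xs ys → R (last xs) (last ys)
Pointwise-last (r ∷ [])         = r
Pointwise-last (r ∷ rs@(_ ∷ _)) = Pointwise-last rs

module _ (p : ℕ) .{{_ : NonZero p}} where

  jpNext : ∀ {k} (α : Vec ℚ (suc k)) → last α - s p (last α) ≢ 0ℚ → Vec ℚ (suc k)
  jpNext α d≢0 = (1/ d) ∷ vmap (λ x → (x - s p x) ÷ d) (init α)
    where
    d = last α - s p (last α)
    instance
      d-nonZero : ℚ.NonZero d
      d-nonZero = ℚ.≢-nonZero d≢0

  jpStep-just : ∀ {k} {α α' : Vec ℚ (suc k)} → jpStep p α ≡ just α' → Σ (last α - s p (last α) ≢ 0ℚ) λ d≢0 → jpNext α d≢0 ≡ α'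
  jpStep-just {α = α} eq with last α - s p (last α) ℚP.≟ 0ℚ
  jpStep-just () | yes _
  ... | no d≢0 = d≢0 , MaybeP.just-injective eq

  jpStep-nothing : ∀ {k} {α : Vec ℚ (suc k)} → jpStep p α ≡ nothing → last α ≡ s p (last α)
  jpStep-nothing {α = α} eq with last α - s p (last α) ℚP.≟ 0ℚ
  ... | yes d≡0 = begin
    last α                        ≡⟨ solve 2 (λ x y → x := (x :- y) :+ y) refl (last α) (s p (last α)) ⟩
    last α - s p (last α) + s p (last α) ≡⟨ cong (_+ s p (last α)) d≡0 ⟩
    0ℚ + s p (last α)             ≡⟨ ℚP.+-identityˡ _ ⟩
    s p (last α)                  ∎
    where
    open ≡-Reasoning
    open ℚ-Solver
  jpStep-nothing () | no _

  jpOrbit-suc : ∀ {k} n (α : Vec ℚ (suc k)) → jpOrbit p (suc n) α ≡ (jpStep p α >>= jpOrbit p n)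
  jpOrbit-suc zero α with jpStep p α
  ... | nothing = refl
  ... | just _  = refl
  jpOrbit-suc (suc n) α rewrite jpOrbit-suc n α with jpStep p α
  ... | nothing = refl
  ... | just _  = refl

module JacobiPerron (p : ℕ) (p-prime : Prime p) (p≢2 : p ≢ 2) where

  open ≡-Reasoning
  open PAdic p p-prime
  open Browkin p p-prime p≢2

  FractionalNumerator : ℤ → ℚ → ℤ → Set
  FractionalNumerator y₀ a z = (a - s p a) * ι y₀ ≡ ι z × p ∣ ℤ.∣ z ∣

  ShrinkBound : ℕ → ℤ → ℤ → ℤ → Set
  ShrinkBound P y₀ x z = 2 ℕ.* P ℕ.* ℤ.∣ z ∣ ℕ.+ ℤ.∣ y₀ ∣ ℕ.≤ 2 ℕ.* ℤ.∣ x ∣ ℕ.+ P ℕ.* P ℕ.* ℤ.∣ y₀ ∣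

  p≤p^suc : ∀ k → p ℕ.≤ p ^ suc k
  p≤p^suc k = ℕP.m≤m*n p (p ^ k) {{ℕP.m^n≢0 p k}}

  fractional-part : ∀ k y₀ → p ∤ ℤ.∣ y₀ ∣ → ∀ a x → a * ι (+ (p ^ suc k) ℤ.* y₀) ≡ ι x →
                    Σ ℤ λ z → FractionalNumerator y₀ a z × ShrinkBound (p ^ suc k) y₀ x z
  fractional-part k y₀ p∤y₀ a x aPy₀≡x =
    z , (proj₂ g-integral , subst (λ w → p ∣ ℤ.∣ w ∣) (trans (cong ↥_ (proj₂ g-integral)) (↥-ι z)) (pℤₚ⇒p∣↥ g∈pℤₚ)) , shrink-inequality p P ℤ.∣ z ∣ ℤ.∣ x ∣ ℤ.∣ c ∣ ℤ.∣ y₀ ∣ (p≤p^suc k) ∣z∣P≤ scaled-small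
    where
    open ℚ-Solver
    P = p ^ suc k
    Pa∈ℤₚ : ℤₚ (ι (+ P) * a)
    Pa∈ℤₚ = frac x y₀ p∤y₀ (begin
      ι (+ P) * a * ι y₀       ≡⟨ solve 3 (λ P a y → P :* a :* y := a :* (P :* y)) refl (ι (+ P)) a (ι y₀) ⟩
      a * (ι (+ P) * ι y₀)     ≡⟨ cong (a *_) (ι-homo-* (+ P) y₀) ⟨
      a * ι (+ P ℤ.* y₀)       ≡⟨ aPy₀≡x ⟩
      ι x                      ∎)
    approximation : BrowkinApprox a (suc k) (s p a)
    approximation = s-approx a (suc k) Pa∈ℤₚ
    open BrowkinApprox approximation renaming (scaled to c; scaled-eq to sP≡c)
    gP≡x-cy₀ : (a - s p a) * ι y₀ * ι (+ P) ≡ ι (x ℤ.- c ℤ.* y₀)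
    gP≡x-cy₀ = begin
      (a - s p a) * ι y₀ * ι (+ P)          ≡⟨ solve 4 (λ a s y P → (a :- s) :* y :* P := a :* (P :* y) :- (s :* P) :* y) refl a (s p a) (ι y₀) (ι (+ P)) ⟩
      a * (ι (+ P) * ι y₀) - (s p a * ι (+ P)) * ι y₀ ≡⟨ cong₂ (λ u w → a * u - w * ι y₀) (sym (ι-homo-* (+ P) y₀)) sP≡c ⟩
      a * ι (+ P ℤ.* y₀) - ι c * ι y₀       ≡⟨ cong₂ _-_ aPy₀≡x (sym (ι-homo-* c y₀)) ⟩
      ι x - ι (c ℤ.* y₀)                    ≡⟨ ι-homo-− x (c ℤ.* y₀) ⟨
      ι (x ℤ.- c ℤ.* y₀)                    ∎
    g∈pℤₚ : pℤₚ ((a - s p a) * ι y₀)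
    g∈pℤₚ = pℤₚ-*-ι y₀ remainder
    g-integral : Σ ℤ λ z → (a - s p a) * ι y₀ ≡ ι z
    g-integral = ℤₚ∧p^k-multiple∈ℤ⇒∈ℤ (suc k) (x ℤ.- c ℤ.* y₀) (pℤₚ⇒ℤₚ g∈pℤₚ) gP≡x-cy₀
    z : ℤ
    z = proj₁ g-integral
    zP≡x-cy₀ : z ℤ.* + P ≡ x ℤ.- c ℤ.* y₀
    zP≡x-cy₀ = ι-injective (trans (ι-homo-* z (+ P)) (trans (cong (_* ι (+ P)) (sym (proj₂ g-integral))) gP≡x-cy₀))
    ∣z∣P≤ : ℤ.∣ z ∣ ℕ.* P ℕ.≤ ℤ.∣ x ∣ ℕ.+ ℤ.∣ c ∣ ℕ.* ℤ.∣ y₀ ∣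
    ∣z∣P≤ = subst₂ ℕ._≤_ (trans (cong ℤ.∣_∣ (sym zP≡x-cy₀)) (ℤP.abs-* z (+ P))) (cong (ℤ.∣ x ∣ ℕ.+_) (ℤP.abs-* c y₀))
              (ℤP.∣i-j∣≤∣i∣+∣j∣ x (c ℤ.* y₀))

  fractional-parts : ∀ {n} k y₀ → p ∤ ℤ.∣ y₀ ∣ → {α : Vec ℚ n} {xs : Vec ℤ n} → Numerators (+ (p ^ suc k) ℤ.* y₀) α xs →
                     Σ (Vec ℤ n) λ zs → Pointwise (FractionalNumerator y₀) α zs × Pointwise (ShrinkBound (p ^ suc k) y₀) xs zs
  fractional-parts k y₀ p∤y₀ [] = [] , [] , []
  fractional-parts k y₀ p∤y₀ {a ∷ _} {x ∷ _} (aPy₀≡x ∷ rest) =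
    let z , fz , bz    = fractional-part k y₀ p∤y₀ a x aPy₀≡x
        zs , fzs , bzs = fractional-parts k y₀ p∤y₀ rest
    in  z ∷ zs , fz ∷ fzs , bz ∷ bzs

  -- The exponent of p is kept positive, so that p^(k+1) ≥ 2 in descent-inequality.
  record Representation {n} (α : Vec ℚ (suc n)) : Set where
    constructor represent
    field
      numerators    : Vec ℤ (suc n)
      k             : ℕ
      y₀            : ℤ
      p∤y₀          : p ∤ ℤ.∣ y₀ ∣
      numerators-eq : Numerators (+ (p ^ suc k) ℤ.* y₀) α numerators

  size : ∀ {n} {α : Vec ℚ (suc n)} → Representation α → ℕ
  size {n} (represent xs k y₀ _ _) = weight xs ℕ.+ suc (weightSum (suc n)) ℕ.* (p ^ suc k ℕ.* ℤ.∣ y₀ ∣)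

  p∤⇒≢0 : ∀ {y} → p ∤ ℤ.∣ y ∣ → y ≢ + 0
  p∤⇒≢0 p∤y refl = p∤y (ℕ∣._∣0 p)

  ≢0⇒∣∣≥1 : ∀ {y} → y ≢ + 0 → 1 ℕ.≤ ℤ.∣ y ∣
  ≢0⇒∣∣≥1 {+ zero}   y≢0 = ⊥-elim (y≢0 refl)
  ≢0⇒∣∣≥1 {+ suc _}  _   = s≤s z≤n
  ≢0⇒∣∣≥1 { -[1+ _ ]} _  = s≤s z≤n

  *-ι≢0 : ∀ {d} {y z : ℤ} → d ≢ 0ℚ → y ≢ + 0 → d * ι y ≡ ι z → z ≢ + 0
  *-ι≢0 {d} {y} d≢0 y≢0 dy≡z refl =
    [ d≢0 ∘ ℚP.↥p≡0⇒p≡0 d , y≢0 ]′ (ℤP.i*j≡0⇒i≡0∨j≡0 (↥ d) (trans (↥*≡*↧ d (+ 0) y dy≡z) (ℤP.*-zeroˡ (↧ d))))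

  jpNext-numerators : ∀ {n} {α : Vec ℚ (suc n)} {zs} y₀ (d≢0 : last α - s p (last α) ≢ 0ℚ) →
                      Pointwise (FractionalNumerator y₀) α zs → Numerators (last zs) (jpNext p α d≢0) (y₀ ∷ init zs)
  jpNext-numerators {α = α} {zs} y₀ d≢0 fractional =
    1/d*zₘ≡y₀ ∷ subst (Numerators zₘ _) (VecP.map-id (init zs))
                  (PW.map⁺ {f = λ x → (x - s p x) ÷ d} {g = λ z → z} (λ {a} {z} → ÷d {a} {z}) (Pointwise-init fractional))
    where
    open ℚ-Solver
    d = last α - s p (last α)
    instance
      d-nonZero : ℚ.NonZero d
      d-nonZero = ℚ.≢-nonZero d≢0
    zₘ = last zs
    dy₀≡zₘ : d * ι y₀ ≡ ι zₘ
    dy₀≡zₘ = proj₁ (Pointwise-last fractional)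
    1/d*zₘ≡y₀ : (1/ d) * ι zₘ ≡ ι y₀
    1/d*zₘ≡y₀ = begin
      (1/ d) * ι zₘ        ≡⟨ cong ((1/ d) *_) dy₀≡zₘ ⟨
      (1/ d) * (d * ι y₀)  ≡⟨ ℚP.*-assoc (1/ d) d (ι y₀) ⟨
      (1/ d) * d * ι y₀    ≡⟨ cong (_* ι y₀) (ℚP.*-inverseˡ d) ⟩
      1ℚ * ι y₀            ≡⟨ ℚP.*-identityˡ (ι y₀) ⟩
      ι y₀                 ∎
    ÷d : ∀ {a z} → FractionalNumerator y₀ a z → ((a - s p a) ÷ d) * ι zₘ ≡ ι z
    ÷d {a} {z} (g≡z , _) = begin
      ((a - s p a) ÷ d) * ι zₘ             ≡⟨ cong (((a - s p a) ÷ d) *_) dy₀≡zₘ ⟨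
      (a - s p a) * (1/ d) * (d * ι y₀)    ≡⟨ solve 4 (λ g u d y → g :* u :* (d :* y) := g :* y :* (u :* d)) refl (a - s p a) (1/ d) d (ι y₀) ⟩
      (a - s p a) * ι y₀ * (1/ d * d)      ≡⟨ cong₂ _*_ g≡z (ℚP.*-inverseˡ d) ⟩
      ι z * 1ℚ                             ≡⟨ ℚP.*-identityʳ (ι z) ⟩
      ι z                                  ∎

  next-representation : ∀ {n} {α : Vec ℚ (suc n)} (R : Representation α) (d≢0 : last α - s p (last α) ≢ 0ℚ) →
                        Σ (Representation (jpNext p α d≢0)) λ R' → size R' ℕ.< size R
  next-representation {n} {α} (represent xs k y₀ p∤y₀ α≡xs/D) d≢0 =
    represent (y₀ ∷ init zs) e y₁ p∤y₁ (subst (λ D → Numerators D (jpNext p α d≢0) (y₀ ∷ init zs)) zₘ≡ (jpNext-numerators y₀ d≢0 fractional)) ,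
    subst (ℕ._< size (represent xs k y₀ p∤y₀ α≡xs/D)) (sym size-next)
      (descent-inequality P ℤ.∣ y₀ ∣ (weight xs) (weight zs) (weightSum (suc n)) (ℕP.≤-trans 1<p (p≤p^suc k))
        (≢0⇒∣∣≥1 {y₀} (p∤⇒≢0 p∤y₀)) (s≤s z≤n) (weight-combine (2 ℕ.* P) ℤ.∣ y₀ ∣ (P ℕ.* P ℕ.* ℤ.∣ y₀ ∣) shrink))
    where
    P = p ^ suc k
    parts = fractional-parts k y₀ p∤y₀ α≡xs/D
    zs = proj₁ parts
    fractional = proj₁ (proj₂ parts)
    shrink = proj₂ (proj₂ parts)
    zₘ = last zs
    open PositiveValuation (p∣⇒positiveValuation zₘ (*-ι≢0 d≢0 (p∤⇒≢0 p∤y₀) (proj₁ (Pointwise-last fractional)))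
                                                   (proj₂ (Pointwise-last fractional)))
      renaming (exponent-1 to e; cofactor to y₁; z≡p^e*y to zₘ≡; p∤cofactor to p∤y₁)
    size-next : weight (y₀ ∷ init zs) ℕ.+ suc (weightSum (suc n)) ℕ.* (p ^ suc e ℕ.* ℤ.∣ y₁ ∣) ≡ ℤ.∣ y₀ ∣ ℕ.+ 2 ℕ.* weight zs
    size-next = trans (cong (λ w → weight (y₀ ∷ init zs) ℕ.+ suc (weightSum (suc n)) ℕ.* w)
                            (trans (sym (ℤP.abs-* (+ (p ^ suc e)) y₁)) (cong ℤ.∣_∣ (sym zₘ≡))))
                      (weight-rotate y₀ zs)

  step-representation : ∀ {n} {α α' : Vec ℚ (suc n)} (R : Representation α) → jpStep p α ≡ just α' →
                         Σ (Representation α') λ R' → size R' ℕ.< size R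
  step-representation {n} {α} R step≡ =
    let d≢0 , next≡α' = jpStep-just p step≡
    in  subst (λ β → Σ (Representation β) λ R' → size R' ℕ.< size R) next≡α' (next-representation R d≢0)

  terminates : ∀ {n} {α : Vec ℚ (suc n)} (R : Representation α) → Acc ℕ._<_ (size R) → JPTerminates p α
  terminates {α = α} R (acc rec) with jpStep p α in step≡
  ... | nothing = 0 , α , refl , jpStep-nothing p step≡
  ... | just α' =
    let R' , smaller           = step-representation R step≡
        m , β , orbit≡ , β-stops = terminates R' (rec smaller)
    in  suc m , β , trans (jpOrbit-suc p m α) (trans (cong (_>>= jpOrbit p m) step≡) orbit≡) , β-stops

  initial-representation : ∀ {n} (α : Vec ℚ (suc n)) → Representation α
  initial-representation α with common-denominator α
  ... | D , D-nonZero , xs , α≡xs/D =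
    represent (vmap (ℤ._* + p) xs) e (+ d) p∤unit (subst (λ E → Numerators E α _) Dp≡pᵉ⁺¹d (Numerators-scale (+ p) α≡xs/D))
    where
    open Factorisation (factorise D {{D-nonZero}}) renaming (exponent to e; unit to d; n≡p^e*u to D≡pᵉd)
    Dp≡pᵉ⁺¹d : + D ℤ.* + p ≡ + (p ^ suc e) ℤ.* + d
    Dp≡pᵉ⁺¹d = begin
      + D ℤ.* + p                ≡⟨ ℤP.pos-* D p ⟨
      + (D ℕ.* p)                ≡⟨ cong (λ w → + (w ℕ.* p)) D≡pᵉd ⟩
      + (p ^ e ℕ.* d ℕ.* p)      ≡⟨ cong +_ (solve 3 (λ q d p → q :* d :* p := p :* q :* d) refl (p ^ e) d p) ⟩
      + (p ^ suc e ℕ.* d)        ≡⟨ ℤP.pos-* (p ^ suc e) d ⟩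
      + (p ^ suc e) ℤ.* + d      ∎
      where open ℕ-Solver

  jp-terminates : ∀ {n} (α : Vec ℚ (suc n)) → JPTerminates p α
  jp-terminates α = terminates R (<-wellFounded (size R))
    where R = initial-representation α

theorem4p11 : (p : ℕ) .{{_ : NonZero p}} → Prime p → p ≢ 2 →
    (k : ℕ) (α₀ : Vec ℚ (suc k)) → JPTerminates p α₀
theorem4p11 p p-prime p≢2 k α₀ = JacobiPerron.jp-terminates p p-prime p≢2 α₀
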